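{- Let $\mathbb T$ be a finite tree and $\mathbb Q$ a finite rooted poset. Let $t\in X^{\mathbb T}$ and $q\in X^{\mathbb Q}$, and assume $q\notin\bigcup\{Q_s: s\in\operatorname{isucc}^{\mathbb T}(t)\}$. Then $q\in Q_t$ if and only if the bipartite graph $\mathbb G_{t,q}$ has a matching with $n$ edges, where $n=|\operatorname{isucc}^{\mathbb Q}(q)|$.
   Context: A finite poset $\mathbb T$ is a tree if it has a least element and every downset $\{s:s\leq t\}$ is a chain. $\operatorname{isucc}^{\mathbb P}(x)$ is the set of immediate successors (elements covering $x$) of $x$ in $\mathbb P$. A $p$-morphism $h$ is a map with (HP) $x\leq y\Rightarrow h(x)\leq h(y)$ and (BP) whenever $h(x)\leq y$ there is $z\geq x$ with $h(z)=y$. For $t\in X^{\mathbb T}$, $Q_t=\{q\in X^{\mathbb Q}: \text{there is a surjective } p\text{ -morphism from } {\uparrow}^{\mathbb T}t \text{ onto } {\uparrow}^{\mathbb Q}q\}$, where ${\uparrow}x$ denotes the principal upset of $x$ as a subposet. $\mathbb G_{t,q}$ is the bipartite graph with parts $\operatorname{isucc}^{\mathbb T}(t)$ and $\operatorname{isucc}^{\mathbb Q}(q)$, in which $s\in\operatorname{isucc}^{\mathbb T}(t)$ and $p\in\operatorname{isucc}^{\mathbb Q}(q)$ are adjacent iff $p\in Q_s$. -}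

module Defs where

open import Level using (0ℓ)
open import Data.Nat using (ℕ)
open import Data.Fin using (Fin)
open import Data.Fin.Properties using (all?; _≟_)
open import Data.List using (List; length; filter)
open import Data.List.Base using (allFin)
open import Data.Product using (Σ; ∃; _×_; _,_; proj₁; proj₂)
open import Data.Sum using (_⊎_)
open import Relation.Nullary using (¬_; Dec)
open import Relation.Nullary.Decidable using (_×-dec_; ¬?; _→-dec_)
open import Relation.Binary using (Rel; IsPartialOrder; Decidable)
open import Relation.Binary.PropositionalEquality using (_≡_)

record FinPoset : Set₁ where
  field
    size : ℕ
    _≤_  : Rel (Fin size) 0ℓ
    isPartialOrder : IsPartialOrder _≡_ _≤_
    _≤?_ : Decidable _≤_

module _ (P : FinPoset) where
  open FinPoset P

  Elt : Set
  Elt = Fin size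

  _<ₚ_ : Elt → Elt → Set
  x <ₚ y = x ≤ y × ¬ (x ≡ y)

  _<?_ : Decidable _<ₚ_
  x <? y = (x ≤? y) ×-dec ¬? (x ≟ y)

  Covers : Elt → Elt → Set
  Covers x y = x <ₚ y × (∀ z → x <ₚ z → z <ₚ y → Data.Empty.⊥)
    where import Data.Empty

  covers? : Decidable Covers
  covers? x y = (x <? y) ×-dec all? (λ z → (x <? z) →-dec ((z <? y) →-dec no⊥))
    where
    open import Data.Empty using (⊥)
    open import Relation.Nullary using (no)
    no⊥ : Dec ⊥
    no⊥ = no (λ ())

  isucc : Elt → List Elt
  isucc x = filter (covers? x) (allFin size)

  #isucc : Elt → ℕ
  #isucc x = length (isucc x)

  HasLeast : Set
  HasLeast = Σ Elt (λ r → ∀ x → r ≤ x)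

  -- principal upset ↑x as a subposet (order inherited on first components)
  Up : Elt → Set
  Up x = Σ Elt (λ y → x ≤ y)

Rooted : FinPoset → Set
Rooted P = HasLeast P

IsTree : FinPoset → Set
IsTree P = HasLeast P × (∀ t a b → a ≤ t → b ≤ t → a ≤ b ⊎ b ≤ a)
  where open FinPoset P

IsSurjPMorphism : (T Q : FinPoset) (t : Elt T) (q : Elt Q) → (Up T t → Up Q q) → Set
IsSurjPMorphism T Q t q h =
    (∀ (a b : Up T t) → proj₁ a ≤T proj₁ b → proj₁ (h a) ≤Q proj₁ (h b))
  × (∀ (a : Up T t) (y : Up Q q) → proj₁ (h a) ≤Q proj₁ y → Σ (Up T t) (λ z → proj₁ a ≤T proj₁ z × proj₁ (h z) ≡ proj₁ y))
  × (∀ (y : Up Q q) → Σ (Up T t) (λ a → proj₁ (h a) ≡ proj₁ y))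
  where
  open FinPoset T renaming (_≤_ to _≤T_)
  open FinPoset Q renaming (_≤_ to _≤Q_)

InQ : (T Q : FinPoset) → Elt T → Elt Q → Set
InQ T Q t q = Σ (Up T t → Up Q q) (IsSurjPMorphism T Q t q)

Adj : (T Q : FinPoset) (t : Elt T) (q : Elt Q) → Elt T → Elt Q → Set
Adj T Q t q s p = Covers T t s × Covers Q q p × InQ T Q s p

HasMatching : (T Q : FinPoset) (t : Elt T) (q : Elt Q) (k : ℕ) → Set
HasMatching T Q t q k =
  Σ (Fin k → Elt T) λ sₑ → Σ (Fin k → Elt Q) λ pₑ →
      (∀ i → Adj T Q t q (sₑ i) (pₑ i))
    × (∀ i j → ¬ (i ≡ j) → ¬ (sₑ i ≡ sₑ j) × ¬ (pₑ i ≡ pₑ j))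

-- If h : ↑t → ↑q is a surjective p-morphism, then h t = q, and for every cover p of q
-- the back property yields some x > t with h x = p; the cover s of t below x satisfies
-- q ≤ h s ≤ p and h s ≠ q (otherwise h restricted to ↑s would put q in Q_s), so h s = p
-- and h restricted to ↑s witnesses p ∈ Q_s. Distinct covers of q get distinct such s,
-- which gives a matching saturating isucc(q).
-- Conversely, given such a matching s_i ↦ p_i with p-morphisms h_i : ↑s_i → ↑p_i, glue
-- them: t goes to q, ↑s_i goes through h_i and every unmatched branch collapses onto a
-- maximal element above q. Because T is a tree, every x > t lies above exactly one cover
-- of t, so this is well defined; the back property at t holds because the n distinct p_i
-- exhaust the n covers of q.
module Submission where

open import Defs
open import Data.Product using (_×_)
open import Relation.Nullary using (¬_)
open import Function.Bundles using (_⇔_; mk⇔)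

open import Data.Empty using (⊥-elim)
open import Data.Fin using (Fin; zero; suc)
open import Data.Fin.Induction using (po-wellFounded; po-noetherian)
open import Data.Fin.Properties using (any?; _≟_; <⇒notInjective)
open import Data.List using (List; lookup; length)
open import Data.List.Base using (allFin)
open import Data.List.Membership.Propositional using (_∈_)
open import Data.List.Membership.Propositional.Properties
  using (∈-filter⁺; ∈-filter⁻; ∈-lookup; ∈-allFin)
open import Data.List.Membership.Setoid.Properties using (index-injective)
import Data.List.Relation.Unary.All as All
open import Data.List.Relation.Unary.AllPairs using (_∷_)
open import Data.List.Relation.Unary.Any using (index)
open import Data.List.Relation.Unary.Unique.Propositional using (Unique)
open import Data.List.Relation.Unary.Unique.Propositional.Properties using (allFin⁺; filter⁺)
open import Data.Nat as ℕ using (ℕ)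
open import Data.Nat.Properties using (n<1+n)
open import Data.Product using (Σ; ∃; _,_; proj₁; proj₂)
open import Data.Sum using (inj₁; inj₂)
open import Function using (_∘_; flip)
open import Function.Definitions using (Injective)
open import Induction.WellFounded using (Acc; acc)
open import Relation.Binary using (IsPartialOrder; DecidableEquality)
import Relation.Binary.Construct.NonStrictToStrict as ToStrict
open import Relation.Binary.PropositionalEquality
  using (_≡_; _≢_; refl; sym; trans; cong; subst; setoid)
open import Relation.Nullary using (yes; no; contradiction)
open import Relation.Nullary.Decidable using (_×-dec_)

lookup-injective : {A : Set} {xs : List A} → Unique xs → Injective _≡_ _≡_ (lookup xs)
lookup-injective (_ ∷ _) {zero} {zero} _ = refl
lookup-injective (x∉xs ∷ _) {zero} {suc j} eq = contradiction eq (All.lookup x∉xs (∈-lookup j))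
lookup-injective (x∉xs ∷ _) {suc i} {zero} eq = contradiction (sym eq) (All.lookup x∉xs (∈-lookup i))
lookup-injective (_ ∷ u) {suc i} {suc j} eq = cong suc (lookup-injective u eq)

injective-into-list-hits : {A : Set} → DecidableEquality A → {xs : List A}
                           (f : Fin (length xs) → A) → Injective _≡_ _≡_ f → (∀ i → f i ∈ xs) →
                           ∀ {x} → x ∈ xs → ∃ λ i → f i ≡ x
injective-into-list-hits _≟A_ {xs} f f-injective f∈xs {x} x∈xs with any? (λ i → f i ≟A x)
... | yes hit = hit
... | no miss = ⊥-elim (<⇒notInjective (n<1+n (length xs)) g-injective)
  where
  g : Fin (ℕ.suc (length xs)) → Fin (length xs)
  g zero    = index x∈xs
  g (suc i) = index (f∈xs i)

  g-injective : Injective _≡_ _≡_ g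
  g-injective {zero} {zero} _ = refl
  g-injective {zero} {suc j} eq =
    contradiction (j , sym (index-injective (setoid _) x∈xs (f∈xs j) eq)) miss
  g-injective {suc i} {zero} eq =
    contradiction (i , index-injective (setoid _) (f∈xs i) x∈xs eq) miss
  g-injective {suc i} {suc j} eq = cong suc (f-injective (index-injective (setoid _) (f∈xs i) (f∈xs j) eq))

module PosetProperties (P : FinPoset) where
  open FinPoset P
  open IsPartialOrder isPartialOrder public
    using (antisym) renaming (refl to ≤-refl; trans to ≤-trans)

  _<_ : Elt P → Elt P → Set
  _<_ = _<ₚ_ P

  <⇒≱ : ∀ {x y} → x < y → ¬ y ≤ x
  <⇒≱ = ToStrict.<⇒≱ _≡_ _≤_ antisym

  Maximal : Elt P → Set
  Maximal m = ∀ {y} → m ≤ y → y ≡ m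

  maximal-above : ∀ x → ∃ λ m → x ≤ m × Maximal m
  maximal-above x = go x (po-noetherian isPartialOrder x)
    where
    go : ∀ x → Acc (flip _<_) x → ∃ λ m → x ≤ m × Maximal m
    go x (acc rs) with any? (_<?_ P x)
    ... | yes (y , x<y) with m , y≤m , m-maximal ← go y (rs x<y) =
      m , ≤-trans (proj₁ x<y) y≤m , m-maximal
    ... | no nothing-above = x , ≤-refl , maximal
      where
      maximal : Maximal x
      maximal {y} x≤y with y ≟ x
      ... | yes y≡x = y≡x
      ... | no y≢x = contradiction (y , x≤y , y≢x ∘ sym) nothing-above

  ⋖⇒≱ : ∀ {x c} → Covers P x c → ¬ c ≤ x
  ⋖⇒≱ = <⇒≱ ∘ proj₁

  cover-below : ∀ {x y} → x < y → ∃ λ c → Covers P x c × c ≤ y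
  cover-below {x} {y} = go y (po-wellFounded isPartialOrder y)
    where
    go : ∀ y → Acc _<_ y → x < y → ∃ λ c → Covers P x c × c ≤ y
    go y (acc rs) x<y with any? (λ z → (_<?_ P x z) ×-dec (_<?_ P z y))
    ... | yes (z , x<z , z<y) with c , x⋖c , c≤z ← go z (rs z<y) x<z =
      c , x⋖c , ≤-trans c≤z (proj₁ z<y)
    ... | no nothing-between = y , (x<y , λ z x<z z<y → nothing-between (z , x<z , z<y)) , ≤-refl

  below-cover-≡ : ∀ {x p y} → Covers P x p → x < y → y ≤ p → y ≡ p
  below-cover-≡ {p = p} {y} (_ , nothing-between) x<y y≤p with y ≟ p
  ... | yes y≡p = y≡p
  ... | no y≢p = ⊥-elim (nothing-between _ x<y (y≤p , y≢p))

  isucc-unique : ∀ x → Unique (isucc P x)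
  isucc-unique x = filter⁺ (covers? P x) (allFin⁺ size)

  ∈-isucc⁺ : ∀ {x p} → Covers P x p → p ∈ isucc P x
  ∈-isucc⁺ {x} {p} = ∈-filter⁺ (covers? P x) (∈-allFin p)

  ∈-isucc⁻ : ∀ {x p} → p ∈ isucc P x → Covers P x p
  ∈-isucc⁻ {x} = proj₂ ∘ ∈-filter⁻ (covers? P x) {xs = allFin size}

module TreeProperties (T : FinPoset) (tree : IsTree T) where
  open FinPoset T
  open PosetProperties T

  covers-below-unique : ∀ {t s s′ x} → Covers T t s → Covers T t s′ → s ≤ x → s′ ≤ x → s ≡ s′
  covers-below-unique {t} {s} {s′} {x} t⋖s t⋖s′ s≤x s′≤x with s ≟ s′ | proj₂ tree x s s′ s≤x s′≤x
  ... | yes s≡s′ | _ = s≡s′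
  ... | no s≢s′ | inj₁ s≤s′ = ⊥-elim (proj₂ t⋖s′ s (proj₁ t⋖s) (s≤s′ , s≢s′))
  ... | no s≢s′ | inj₂ s′≤s = ⊥-elim (proj₂ t⋖s s′ (proj₁ t⋖s′) (s′≤s , s≢s′ ∘ sym))

module _ (T Q : FinPoset) (t : Elt T) (q : Elt Q) where
  open FinPoset T using () renaming (_≤_ to _≤T_)
  open FinPoset Q using () renaming (_≤_ to _≤Q_)

  Monotone : (Up T t → Up Q q) → Set
  Monotone h = ∀ (a b : Up T t) → proj₁ a ≤T proj₁ b → proj₁ (h a) ≤Q proj₁ (h b)

  HasBackProperty : (Up T t → Up Q q) → Set
  HasBackProperty h = ∀ (a : Up T t) (y : Up Q q) → proj₁ (h a) ≤Q proj₁ y →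
                    Σ (Up T t) λ z → proj₁ a ≤T proj₁ z × proj₁ (h z) ≡ proj₁ y

  root-preserving-pmorphism : (h : Up T t → Up Q q) → Monotone h → HasBackProperty h →
                              proj₁ (h (t , PosetProperties.≤-refl T)) ≡ q →
                              InQ T Q t q
  root-preserving-pmorphism h mono back h-root = h , mono , back , onto
    where
    onto : ∀ (y : Up Q q) → Σ (Up T t) λ a → proj₁ (h a) ≡ proj₁ y
    onto (y , q≤y) with z , _ , hz≡y ← back _ (y , q≤y) (subst (_≤Q y) (sym h-root) q≤y) = z , hz≡y

module SurjPMorphism (T Q : FinPoset) (t : Elt T) (q : Elt Q) (φ : InQ T Q t q) where
  open FinPoset T using () renaming (_≤_ to _≤T_)
  open FinPoset Q using () renaming (_≤_ to _≤Q_)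
  private
    module T = PosetProperties T
    module Q = PosetProperties Q

  value : (x : Elt T) → t ≤T x → Elt Q
  value x t≤x = proj₁ (proj₁ φ (x , t≤x))

  value-above : ∀ {x} (t≤x : t ≤T x) → q ≤Q value x t≤x
  value-above t≤x = proj₂ (proj₁ φ (_ , t≤x))

  value-mono : ∀ {x y} {t≤x : t ≤T x} {t≤y : t ≤T y} → x ≤T y → value x t≤x ≤Q value y t≤y
  value-mono = proj₁ (proj₂ φ) _ _

  value-cong : ∀ {x y} {t≤x : t ≤T x} {t≤y : t ≤T y} → x ≡ y → value x t≤x ≡ value y t≤y
  value-cong refl = Q.antisym (value-mono T.≤-refl) (value-mono T.≤-refl)

  value-back : ∀ {x y} {t≤x : t ≤T x} → value x t≤x ≤Q y →
               ∃ λ z → Σ (t ≤T z) λ t≤z → x ≤T z × value z t≤z ≡ y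
  value-back {t≤x = t≤x} hx≤y
    with (z , t≤z) , x≤z , hz≡y ← proj₁ (proj₂ (proj₂ φ)) _ (_ , Q.≤-trans (value-above t≤x) hx≤y) hx≤y =
    z , t≤z , x≤z , hz≡y

  value-onto : ∀ {y} → q ≤Q y → ∃ λ z → Σ (t ≤T z) λ t≤z → value z t≤z ≡ y
  value-onto {y} q≤y with (z , t≤z) , hz≡y ← proj₂ (proj₂ (proj₂ φ)) (y , q≤y) = z , t≤z , hz≡y

  value-root : value t T.≤-refl ≡ q
  value-root with z , t≤z , hz≡q ← value-onto Q.≤-refl =
    Q.antisym (subst (value t T.≤-refl ≤Q_) hz≡q (value-mono t≤z)) (value-above T.≤-refl)

  restrict : ∀ {s} (t≤s : t ≤T s) → InQ T Q s (value s t≤s)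
  restrict {s} t≤s = root-preserving-pmorphism T Q s _ h′ (λ _ _ → value-mono) back (value-cong refl)
    where
    h′ : Up T s → Up Q (value s t≤s)
    h′ (x , s≤x) = value x (T.≤-trans t≤s s≤x) , value-mono s≤x

    back : HasBackProperty T Q s (value s t≤s) h′
    back (x , s≤x) (y , _) hx≤y with z , _ , x≤z , hz≡y ← value-back hx≤y =
      (z , T.≤-trans s≤x x≤z) , x≤z , trans (value-cong refl) hz≡y

module ToMatching (T Q : FinPoset) (t : Elt T) (q : Elt Q)
                  (q∉Qₛ : ∀ s → Covers T t s → ¬ InQ T Q s q) (φ : InQ T Q t q) where
  open FinPoset T using () renaming (_≤_ to _≤T_)
  open FinPoset Q using () renaming (_≤_ to _≤Q_)
  open SurjPMorphism T Q t q φ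
  private
    module T = PosetProperties T
    module Q = PosetProperties Q

  cover-lift : ∀ {p} → Covers Q q p → ∃ λ s → Σ (Covers T t s) λ t⋖s → value s (proj₁ (proj₁ t⋖s)) ≡ p
  cover-lift {p} q⋖p@((q≤p , q≢p) , _)
    with z , t≤z , hz≡p ← value-onto q≤p
    with s , t⋖s@((t≤s , _) , _) , s≤z
           ← T.cover-below (t≤z , λ t≡z → q≢p (trans (sym value-root) (trans (value-cong t≡z) hz≡p)))
    = s , t⋖s , Q.below-cover-≡ q⋖p (value-above t≤s , q≢hs) hs≤p
      where
      hs≤p : value s t≤s ≤Q p
      hs≤p = subst (value s t≤s ≤Q_) hz≡p (value-mono s≤z)

      q≢hs : q ≢ value s t≤s
      q≢hs q≡hs = q∉Qₛ s t⋖s (subst (InQ T Q s) (sym q≡hs) (restrict t≤s))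

  matching : HasMatching T Q t q (#isucc Q q)
  matching = sₑ , pₑ , adjacent , disjoint
    where
    pₑ : Fin (#isucc Q q) → Elt Q
    pₑ = lookup (isucc Q q)

    q⋖pₑ : ∀ i → Covers Q q (pₑ i)
    q⋖pₑ i = Q.∈-isucc⁻ (∈-lookup i)

    sₑ : Fin (#isucc Q q) → Elt T
    sₑ i = proj₁ (cover-lift (q⋖pₑ i))

    t⋖sₑ : ∀ i → Covers T t (sₑ i)
    t⋖sₑ i = proj₁ (proj₂ (cover-lift (q⋖pₑ i)))

    hsₑ≡pₑ : ∀ i → value (sₑ i) (proj₁ (proj₁ (t⋖sₑ i))) ≡ pₑ i
    hsₑ≡pₑ i = proj₂ (proj₂ (cover-lift (q⋖pₑ i)))

    adjacent : ∀ i → Adj T Q t q (sₑ i) (pₑ i)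
    adjacent i = t⋖sₑ i , q⋖pₑ i , subst (InQ T Q (sₑ i)) (hsₑ≡pₑ i) (restrict _)

    p-injective : Injective _≡_ _≡_ pₑ
    p-injective = lookup-injective (Q.isucc-unique q)

    disjoint : ∀ i j → i ≢ j → sₑ i ≢ sₑ j × pₑ i ≢ pₑ j
    disjoint i j i≢j = s-distinct , i≢j ∘ p-injective
      where
      s-distinct : sₑ i ≢ sₑ j
      s-distinct si≡sj =
        i≢j (p-injective (trans (sym (hsₑ≡pₑ i)) (trans (value-cong si≡sj) (hsₑ≡pₑ j))))

module FromMatching (T Q : FinPoset) (tree : IsTree T) (t : Elt T) (q : Elt Q)
                    (M : HasMatching T Q t q (#isucc Q q)) where
  open FinPoset T using () renaming (_≤_ to _≤T_)
  open FinPoset Q using () renaming (_≤_ to _≤Q_)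
  open TreeProperties T tree
  private
    module T = PosetProperties T
    module Q = PosetProperties Q

  n : ℕ
  n = #isucc Q q

  sₑ : Fin n → Elt T
  sₑ = proj₁ M

  pₑ : Fin n → Elt Q
  pₑ = proj₁ (proj₂ M)

  t⋖sₑ : ∀ i → Covers T t (sₑ i)
  t⋖sₑ i = proj₁ (proj₁ (proj₂ (proj₂ M)) i)

  t≤sₑ : ∀ i → t ≤T sₑ i
  t≤sₑ i = proj₁ (proj₁ (t⋖sₑ i))

  q⋖pₑ : ∀ i → Covers Q q (pₑ i)
  q⋖pₑ i = proj₁ (proj₂ (proj₁ (proj₂ (proj₂ M)) i))

  module Φ (i : Fin n) = SurjPMorphism T Q (sₑ i) (pₑ i) (proj₂ (proj₂ (proj₁ (proj₂ (proj₂ M)) i)))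

  s-injective : Injective _≡_ _≡_ sₑ
  s-injective {i} {j} sᵢ≡sⱼ with i ≟ j
  ... | yes i≡j = i≡j
  ... | no i≢j = contradiction sᵢ≡sⱼ (proj₁ (proj₂ (proj₂ (proj₂ M)) i j i≢j))

  p-injective : Injective _≡_ _≡_ pₑ
  p-injective {i} {j} pᵢ≡pⱼ with i ≟ j
  ... | yes i≡j = i≡j
  ... | no i≢j = contradiction pᵢ≡pⱼ (proj₂ (proj₂ (proj₂ (proj₂ M)) i j i≢j))

  cover-matched : ∀ {p} → Covers Q q p → ∃ λ i → pₑ i ≡ p
  cover-matched q⋖p =
    injective-into-list-hits _≟_ pₑ p-injective (Q.∈-isucc⁺ ∘ q⋖pₑ) (Q.∈-isucc⁺ q⋖p)

  m : Elt Q
  m = proj₁ (Q.maximal-above q)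

  q≤m : q ≤Q m
  q≤m = proj₁ (proj₂ (Q.maximal-above q))

  m-maximal : Q.Maximal m
  m-maximal = proj₂ (proj₂ (Q.maximal-above q))

  data Branch (x : Elt T) : Set where
    root      : x ≡ t → Branch x
    matched   : ∀ i → sₑ i ≤T x → Branch x
    unmatched : ∀ {c} → Covers T t c → c ≤T x → (∀ i → sₑ i ≢ c) → Branch x

  branch : ∀ x → t ≤T x → Branch x
  branch x t≤x with x ≟ t
  ... | yes x≡t = root x≡t
  ... | no x≢t with c , t⋖c , c≤x ← T.cover-below (t≤x , x≢t ∘ sym) with any? (λ i → sₑ i ≟ c)
  ...   | yes (i , refl) = matched i c≤x
  ...   | no unmatched-c = unmatched t⋖c c≤x (λ i sᵢ≡c → unmatched-c (i , sᵢ≡c))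

  image : ∀ {x} → Branch x → Elt Q
  image (root _)          = q
  image (matched i sᵢ≤x)  = Φ.value i _ sᵢ≤x
  image (unmatched _ _ _) = m

  image-above : ∀ {x} (b : Branch x) → q ≤Q image b
  image-above (root _)          = Q.≤-refl
  image-above (matched i sᵢ≤x)  = Q.≤-trans (proj₁ (proj₁ (q⋖pₑ i))) (Φ.value-above i sᵢ≤x)
  image-above (unmatched _ _ _) = q≤m

  image-unique : ∀ {x} (b b′ : Branch x) → image b ≡ image b′
  image-unique (root _) (root _) = refl
  image-unique (root refl) (matched i sᵢ≤t) = contradiction sᵢ≤t (T.⋖⇒≱ (t⋖sₑ i))
  image-unique (root refl) (unmatched t⋖c c≤t _) = contradiction c≤t (T.⋖⇒≱ t⋖c)
  image-unique (matched i sᵢ≤t) (root refl) = contradiction sᵢ≤t (T.⋖⇒≱ (t⋖sₑ i))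
  image-unique (matched i sᵢ≤x) (matched j sⱼ≤x)
    with refl ← s-injective (covers-below-unique (t⋖sₑ i) (t⋖sₑ j) sᵢ≤x sⱼ≤x) = Φ.value-cong i refl
  image-unique (matched i sᵢ≤x) (unmatched t⋖c c≤x c-unmatched) =
    contradiction (covers-below-unique (t⋖sₑ i) t⋖c sᵢ≤x c≤x) (c-unmatched i)
  image-unique (unmatched t⋖c c≤t _) (root refl) = contradiction c≤t (T.⋖⇒≱ t⋖c)
  image-unique (unmatched t⋖c c≤x c-unmatched) (matched i sᵢ≤x) =
    contradiction (covers-below-unique (t⋖sₑ i) t⋖c sᵢ≤x c≤x) (c-unmatched i)
  image-unique (unmatched _ _ _) (unmatched _ _ _) = refl

  glued : Up T t → Up Q q
  glued (x , t≤x) = image (branch x t≤x) , image-above (branch x t≤x)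

  image-mono : ∀ {x y} → x ≤T y → (b : Branch x) (b′ : Branch y) → image b ≤Q image b′
  image-mono _ (root _) b′ = image-above b′
  image-mono x≤y (matched i sᵢ≤x) b′ =
    subst (_ ≤Q_) (image-unique (matched i (T.≤-trans sᵢ≤x x≤y)) b′) (Φ.value-mono i x≤y)
  image-mono x≤y (unmatched t⋖c c≤x c-unmatched) b′ =
    subst (m ≤Q_) (image-unique (unmatched t⋖c (T.≤-trans c≤x x≤y) c-unmatched) b′) Q.≤-refl

  image-back : ∀ {x y} → q ≤Q y → (b : Branch x) → image b ≤Q y →
               ∃ λ z → Σ (t ≤T z) λ t≤z → x ≤T z × image (branch z t≤z) ≡ y
  image-back {y = y} q≤y (root refl) _ with y ≟ q
  ... | yes refl = t , T.≤-refl , T.≤-refl , image-unique (branch t T.≤-refl) (root refl)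
  ... | no y≢q with p , q⋖p , p≤y ← Q.cover-below (q≤y , y≢q ∘ sym) | cover-matched q⋖p
  ...   | i , refl with z , sᵢ≤z , hz≡y ← Φ.value-onto i p≤y =
    z , t≤z , t≤z , trans (image-unique (branch z t≤z) (matched i sᵢ≤z)) hz≡y
    where
    t≤z : t ≤T z
    t≤z = T.≤-trans (t≤sₑ i) sᵢ≤z
  image-back _ (matched i sᵢ≤x) hx≤y with z , sᵢ≤z , x≤z , hz≡y ← Φ.value-back i hx≤y =
    z , t≤z , x≤z , trans (image-unique (branch z t≤z) (matched i sᵢ≤z)) hz≡y
    where
    t≤z : t ≤T z
    t≤z = T.≤-trans (t≤sₑ i) sᵢ≤z
  image-back {x} _ b@(unmatched t⋖c c≤x _) m≤y =
    x , t≤x , T.≤-refl , trans (image-unique (branch x t≤x) b) (sym (m-maximal m≤y))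
    where
    t≤x : t ≤T x
    t≤x = T.≤-trans (proj₁ (proj₁ t⋖c)) c≤x

  glued-pmorphism : InQ T Q t q
  glued-pmorphism = root-preserving-pmorphism T Q t q glued
    (λ (x , t≤x) (y , t≤y) x≤y → image-mono x≤y (branch x t≤x) (branch y t≤y))
    (λ (x , t≤x) (y , q≤y) hx≤y → let z , t≤z , x≤z , hz≡y = image-back q≤y (branch x t≤x) hx≤y
                                   in (z , t≤z) , x≤z , hz≡y)
    (image-unique (branch t T.≤-refl) (root refl))

lemma14 : (T Q : FinPoset) → IsTree T → Rooted Q →
          (t : Elt T) (q : Elt Q) →
          (∀ s → Covers T t s → ¬ InQ T Q s q) →
          InQ T Q t q ⇔ HasMatching T Q t q (#isucc Q q)
lemma14 T Q tree _ t q q∉Qₛ =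
  mk⇔ (ToMatching.matching T Q t q q∉Qₛ) (FromMatching.glued-pmorphism T Q tree t q)
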